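{- Let $q=p^n$ with $p$ prime and let $f:\mathbb{F}_q\to\mathbb{F}_q$ be a non-constant function. If $|D_f^{ -1}D_f|\leq (q+1)/2$, then $f$ is a permutation of $\mathbb{F}_q$.
   Context: $D_f=\{(f(x)-f(y))/(x-y) : x,y\in\mathbb{F}_q,\ x\neq y\}$ is the set of directions determined by $f$. For $A,B\subseteq\mathbb{F}_q$: $A^{ -1}=\{a^{ -1} : a\in A\setminus\{0\}\}$ and $AB=\{ab : a\in A,\ b\in B\}$. -}

module Defs where

open import Data.Nat using (ℕ)
open import Data.Fin using (Fin; _≟_)
open import Data.Fin.Properties using (any?)
open import Data.List using (List; length; filter)
open import Data.List.Base using ()
open import Data.Fin.Base using ()
open import Data.Product using (Σ; ∃; _×_; _,_)
open import Relation.Nullary using (¬_; Dec)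

open import Relation.Nullary.Decidable using (_×-dec_; ¬?)
open import Relation.Binary.PropositionalEquality using (_≡_; _≢_)
open import Algebra.Structures using (IsCommutativeRing)
import Data.List as L
import Data.Fin as F

-- A finite field with q elements, presented (up to isomorphism) on the
-- carrier Fin q with propositional equality.  The inverse map is total;
-- its value at 0 is irrelevant (only inverses of nonzero elements are used).
record FiniteField (q : ℕ) : Set where
  infixl 6 _+_
  infixl 7 _*_
  field
    _+_ _*_ : Fin q → Fin q → Fin q
    -_ : Fin q → Fin q
    0# 1# : Fin q
    _⁻¹ : Fin q → Fin q
    isCommutativeRing : IsCommutativeRing _≡_ _+_ _*_ -_ 0# 1#
    0≢1 : 0# ≢ 1#
    *-inverse : ∀ x → x ≢ 0# → x * (x ⁻¹) ≡ 1#

  _-_ : Fin q → Fin q → Fin q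
  x - y = x + (- y)

module _ {q : ℕ} (𝔽 : FiniteField q) where
  open FiniteField 𝔽

  InDirections : (Fin q → Fin q) → Fin q → Set
  InDirections f d = ∃ λ x → ∃ λ y → (x ≢ y) × (d ≡ (f x - f y) * ((x - y) ⁻¹))

  InQuotientSet : (Fin q → Fin q) → Fin q → Set
  InQuotientSet f c = ∃ λ a → ∃ λ b →
    (InDirections f a × (a ≢ 0#) × InDirections f b × (c ≡ (a ⁻¹) * b))

  inDirections? : ∀ f d → Dec (InDirections f d)
  inDirections? f d = any? λ x → any? λ y →
    ¬? (x ≟ y) ×-dec (d ≟ ((f x - f y) * ((x - y) ⁻¹)))

  inQuotientSet? : ∀ f c → Dec (InQuotientSet f c)
  inQuotientSet? f c = any? λ a → any? λ b →
    inDirections? f a ×-dec (¬? (a ≟ 0#) ×-dec (inDirections? f b ×-dec (c ≟ ((a ⁻¹) * b))))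

  quotientSetSize : (Fin q → Fin q) → ℕ
  quotientSetSize f = length (filter (inQuotientSet? f) (L.allFin q))

{-# OPTIONS --safe #-}
-- Suppose f a = f b with a ≠ b, and pick z₀ with f z₀ ≠ f a.  Writing d x y for the direction
-- (f x - f y)/(x - y), every z outside the fibre F of f a gives the element
-- d(z,a)⁻¹ d(z,b) = (z - a)/(z - b) of Q = D_f⁻¹ D_f, and every w ∈ F gives
-- d(z₀,a)⁻¹ d(z₀,w) = (z₀ - a)/(z₀ - w).  Both maps are injective and nonzero, so the q points
-- of F_q embed into two copies of Q ∖ {0}; as 0 = d(z₀,a)⁻¹ d(a,b) ∈ Q, this forces
-- 2|Q| ≥ q + 2.  Hence f is injective, so bijective.
module Submission where

open import Defs
open import Data.Nat using (ℕ; suc)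
open import Data.Nat.Primality using (Prime)
import Data.Nat.Properties as ℕ
open import Data.Fin using (Fin; zero; suc; _≟_; join; punchOut)
open import Data.Fin.Properties using (any?; injective⇒≤; punchOut-injective; +↔⊎)
open import Data.List using (List; length; filter; allFin; lookup)
open import Data.List.Relation.Unary.Any using (index)
open import Data.List.Relation.Unary.Any.Properties using (lookup-index)
open import Data.List.Membership.Propositional.Properties using (∈-filter⁺; ∈-allFin)
open import Data.Product using (∃; _×_; _,_)
open import Data.Sum using (_⊎_; inj₁; inj₂)
open import Data.Sum.Properties using (inj₁-injective; inj₂-injective)
open import Data.Sum.Relation.Unary.All using (All; inj₁; inj₂)
open import Data.Vec.Functional using (_∷_)
open import Function.Bundles using (Injection)
open import Function.Construct.Symmetry using (↔-sym)
open import Function.Definitions using (Bijective; Injective; Surjective)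
open import Function.Properties.Inverse using (↔⇒↣)
open import Level using (Level; 0ℓ)
open import Relation.Nullary using (yes; no; contradiction)
open import Relation.Unary using (Pred; Decidable)
open import Relation.Binary.PropositionalEquality using (_≡_; _≢_; refl; sym; trans; cong; cong₂; subst; ≢-sym; module ≡-Reasoning)
open import Algebra.Bundles using (CommutativeRing)
import Algebra.Properties.AbelianGroup as AbelianGroupProperties
import Algebra.Properties.Ring as RingProperties

module FieldProperties {q} (𝔽 : FiniteField q) where
  open FiniteField 𝔽

  commutativeRing : CommutativeRing 0ℓ 0ℓ
  commutativeRing = record { isCommutativeRing = isCommutativeRing }

  open CommutativeRing commutativeRing
    using (+-comm; +-assoc; *-comm; *-assoc; *-identityˡ; *-identityʳ; zeroˡ; ring; +-abelianGroup)
  open RingProperties ring using ([y-z]x≈yx-zx)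
  open AbelianGroupProperties +-abelianGroup
    using (⁻¹-anti-homo‿-; \\-leftDividesʳ; ∙-cancelˡ; ∙-cancelʳ; ⁻¹-injective)
  open AbelianGroupProperties +-abelianGroup public
    using () renaming (x∙y⁻¹≈ε⇒x≈y to x-y≡0⇒x≡y; x≈y⇒x∙y⁻¹≈ε to x≡y⇒x-y≡0)
  open ≡-Reasoning

  private
    variable
      a b r s t u w x y z z′ w′ : Fin q

  x≢y⇒x-y≢0 : x ≢ y → x - y ≢ 0#
  x≢y⇒x-y≢0 x≢y x-y≡0 = x≢y (x-y≡0⇒x≡y _ _ x-y≡0)

  [x-y]-[x-z]≡z-y : ∀ x y z → (x - y) - (x - z) ≡ z - y
  [x-y]-[x-z]≡z-y x y z = begin
    (x - y) - (x - z)   ≡⟨ cong ((x - y) +_) (⁻¹-anti-homo‿- x z) ⟩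
    (x - y) + (z - x)   ≡⟨ +-comm (x - y) (z - x) ⟩
    (z - x) + (x - y)   ≡⟨ +-assoc z (- x) (x - y) ⟩
    z + (- x + (x - y)) ≡⟨ cong (z +_) (\\-leftDividesʳ x (- y)) ⟩
    z - y               ∎

  x*y≡z≢0⇒x≢0 : x * y ≡ z → z ≢ 0# → x ≢ 0#
  x*y≡z≢0⇒x≢0 {y = y} refl z≢0 refl = z≢0 (zeroˡ y)

  ⁻¹-inverseˡ : x ≢ 0# → x ⁻¹ * x ≡ 1#
  ⁻¹-inverseˡ {x} x≢0 = trans (*-comm (x ⁻¹) x) (*-inverse x x≢0)

  *-cancelˡ : u ≢ 0# → u * x ≡ u * y → x ≡ y
  *-cancelˡ {u} {x} {y} u≢0 ux≡uy = begin
    x              ≡⟨ *-identityˡ x ⟨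
    1# * x         ≡⟨ cong (_* x) (⁻¹-inverseˡ u≢0) ⟨
    (u ⁻¹ * u) * x ≡⟨ *-assoc (u ⁻¹) u x ⟩
    u ⁻¹ * (u * x) ≡⟨ cong (u ⁻¹ *_) ux≡uy ⟩
    u ⁻¹ * (u * y) ≡⟨ *-assoc (u ⁻¹) u y ⟨
    (u ⁻¹ * u) * y ≡⟨ cong (_* y) (⁻¹-inverseˡ u≢0) ⟩
    1# * y         ≡⟨ *-identityˡ y ⟩
    y              ∎

  [x*y⁻¹]*y≡x : y ≢ 0# → (x * y ⁻¹) * y ≡ x
  [x*y⁻¹]*y≡x {y} {x} y≢0 = begin
    (x * y ⁻¹) * y ≡⟨ *-assoc x (y ⁻¹) y ⟩
    x * (y ⁻¹ * y) ≡⟨ cong (x *_) (⁻¹-inverseˡ y≢0) ⟩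
    x * 1#         ≡⟨ *-identityʳ x ⟩
    x              ∎

  [x⁻¹*y]*t≡s : x ≢ 0# → x * s ≡ y * t → (x ⁻¹ * y) * t ≡ s
  [x⁻¹*y]*t≡s {x} {s} {y} {t} x≢0 xs≡yt = begin
    (x ⁻¹ * y) * t ≡⟨ *-assoc (x ⁻¹) y t ⟩
    x ⁻¹ * (y * t) ≡⟨ cong (x ⁻¹ *_) xs≡yt ⟨
    x ⁻¹ * (x * s) ≡⟨ *-assoc (x ⁻¹) x s ⟨
    (x ⁻¹ * x) * s ≡⟨ cong (_* s) (⁻¹-inverseˡ x≢0) ⟩
    1# * s         ≡⟨ *-identityˡ s ⟩
    s              ∎

  -- The solution of r (z - b) = z - a is unique since (r - 1)(z - b) = b - a ≠ 0.
  r*[z-b]≡z-a-unique : a ≢ b → r * (z - b) ≡ z - a → r * (z′ - b) ≡ z′ - a → z ≡ z′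
  r*[z-b]≡z-a-unique {a} {b} {r} {z} {z′} a≢b eq eq′ =
    ∙-cancelʳ (- b) z z′ (*-cancelˡ r-1≢0 (trans (shift eq) (sym (shift eq′))))
    where
    shift : ∀ {z} → r * (z - b) ≡ z - a → (r - 1#) * (z - b) ≡ b - a
    shift {z} eq = begin
      (r - 1#) * (z - b)             ≡⟨ [y-z]x≈yx-zx (z - b) r 1# ⟩
      (r * (z - b)) - (1# * (z - b)) ≡⟨ cong₂ _-_ eq (*-identityˡ (z - b)) ⟩
      (z - a) - (z - b)              ≡⟨ [x-y]-[x-z]≡z-y z a b ⟩
      b - a                          ∎
    r-1≢0 : r - 1# ≢ 0#
    r-1≢0 = x*y≡z≢0⇒x≢0 (shift eq) (x≢y⇒x-y≢0 (≢-sym a≢b))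

  r*[x-w]≡x-y-unique : x ≢ y → r * (x - w) ≡ x - y → r * (x - w′) ≡ x - y → w ≡ w′
  r*[x-w]≡x-y-unique {x} {y} {r} {w} {w′} x≢y eq eq′ =
    ⁻¹-injective (∙-cancelˡ x (- w) (- w′) (*-cancelˡ r≢0 (trans eq (sym eq′))))
    where
    r≢0 : r ≢ 0#
    r≢0 = x*y≡z≢0⇒x≢0 eq (x≢y⇒x-y≢0 x≢y)

module Directions {q} (𝔽 : FiniteField q) (f : Fin q → Fin q) where
  open FiniteField 𝔽
  open FieldProperties 𝔽
  open CommutativeRing commutativeRing using (zeroˡ; zeroʳ)
  open ≡-Reasoning

  private
    variable
      a b w x y z z′ w′ : Fin q

  fx≢fy⇒x≢y : f x ≢ f y → x ≢ y
  fx≢fy⇒x≢y fx≢fy x≡y = fx≢fy (cong f x≡y)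

  direction : Fin q → Fin q → Fin q
  direction x y = (f x - f y) * (x - y) ⁻¹

  direction∈D : x ≢ y → InDirections 𝔽 f (direction x y)
  direction∈D x≢y = _ , _ , x≢y , refl

  direction-spec : x ≢ y → direction x y * (x - y) ≡ f x - f y
  direction-spec x≢y = [x*y⁻¹]*y≡x (x≢y⇒x-y≢0 x≢y)

  direction≢0 : f x ≢ f y → direction x y ≢ 0#
  direction≢0 fx≢fy = x*y≡z≢0⇒x≢0 (direction-spec (fx≢fy⇒x≢y fx≢fy)) (x≢y⇒x-y≢0 fx≢fy)

  direction≡0 : f x ≡ f y → direction x y ≡ 0#
  direction≡0 {x} {y} fx≡fy = trans (cong (_* (x - y) ⁻¹) (x≡y⇒x-y≡0 fx≡fy)) (zeroˡ ((x - y) ⁻¹))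

  collision⇒0∈Q : f x ≢ f y → a ≢ b → f a ≡ f b → InQuotientSet 𝔽 f 0#
  collision⇒0∈Q {x} {y} fx≢fy a≢b fa≡fb =
    _ , _ , direction∈D (fx≢fy⇒x≢y fx≢fy) , direction≢0 fx≢fy , direction∈D a≢b ,
    sym (trans (cong (direction x y ⁻¹ *_) (direction≡0 fa≡fb)) (zeroʳ (direction x y ⁻¹)))

  ratio : Fin q → Fin q → Fin q → Fin q
  ratio x y w = direction x y ⁻¹ * direction x w

  module _ (fx≢fy : f x ≢ f y) (fy≡fw : f y ≡ f w) where

    private
      fx≢fw : f x ≢ f w
      fx≢fw fx≡fw = fx≢fy (trans fx≡fw (sym fy≡fw))

    ratio∈Q : InQuotientSet 𝔽 f (ratio x y w)
    ratio∈Q = _ , _ , direction∈D (fx≢fy⇒x≢y fx≢fy) , direction≢0 fx≢fy ,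
              direction∈D (fx≢fy⇒x≢y fx≢fw) , refl

    ratio-spec : ratio x y w * (x - w) ≡ x - y
    ratio-spec = [x⁻¹*y]*t≡s (direction≢0 fx≢fy) (begin
      direction x y * (x - y) ≡⟨ direction-spec (fx≢fy⇒x≢y fx≢fy) ⟩
      f x - f y               ≡⟨ cong (λ v → f x - v) fy≡fw ⟩
      f x - f w               ≡⟨ direction-spec (fx≢fy⇒x≢y fx≢fw) ⟨
      direction x w * (x - w) ∎)

    ratio≢0 : ratio x y w ≢ 0#
    ratio≢0 = x*y≡z≢0⇒x≢0 ratio-spec (x≢y⇒x-y≢0 (fx≢fy⇒x≢y fx≢fy))

  ratio-injective₁ : a ≢ b → f a ≡ f b → f z ≢ f a → f z′ ≢ f a →
                     ratio z a b ≡ ratio z′ a b → z ≡ z′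
  ratio-injective₁ {a} {b} {z} {z′} a≢b fa≡fb fz≢fa fz′≢fa eq =
    r*[z-b]≡z-a-unique a≢b (ratio-spec fz≢fa fa≡fb)
      (subst (λ r → r * (z′ - b) ≡ z′ - a) (sym eq) (ratio-spec fz′≢fa fa≡fb))

  ratio-injective₃ : f x ≢ f a → f w ≡ f a → f w′ ≡ f a → ratio x a w ≡ ratio x a w′ → w ≡ w′
  ratio-injective₃ {x} {a} {w} {w′} fx≢fa fw≡fa fw′≡fa eq =
    r*[x-w]≡x-y-unique (fx≢fy⇒x≢y fx≢fa) (ratio-spec fx≢fa (sym fw≡fa))
      (subst (λ r → r * (x - w′) ≡ x - a) (sym eq) (ratio-spec fx≢fa (sym fw′≡fa)))

-- Opened only from here on, as the field operations above are also named _+_ and _*_.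
open import Data.Nat using (_^_; _≤_; _<_; _*_; _+_)

private
  variable
    ℓ : Level
    A : Set ℓ
    m n : ℕ

injective⇒surjective : {f : Fin n → Fin n} → Injective _≡_ _≡_ f → Surjective _≡_ _≡_ f
injective⇒surjective {suc n} {f} f-injective y with any? (λ x → f x ≟ y)
... | yes (x , fx≡y) = x , λ { refl → fx≡y }
... | no ∄x = contradiction (injective⇒≤ punchOut∘f-injective) ℕ.1+n≰n
  where
  f≢y : ∀ x → y ≢ f x
  f≢y x y≡fx = ∄x (x , sym y≡fx)
  punchOut∘f-injective : Injective _≡_ _≡_ (λ x → punchOut (f≢y x))
  punchOut∘f-injective {x} {x′} eq = f-injective (punchOut-injective (f≢y x) (f≢y x′) eq)

fresh∷-injective : {h : Fin n → A} {x : A} → (∀ i → h i ≢ x) →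
                   Injective _≡_ _≡_ h → Injective _≡_ _≡_ (x ∷ h)
fresh∷-injective fresh h-injective {zero}  {zero}  _  = refl
fresh∷-injective fresh h-injective {zero}  {suc j} eq = contradiction (sym eq) (fresh j)
fresh∷-injective fresh h-injective {suc i} {zero}  eq = contradiction eq (fresh i)
fresh∷-injective fresh h-injective {suc i} {suc j} eq = cong suc (h-injective eq)

join-injective : ∀ m n → Injective _≡_ _≡_ (join m n)
join-injective m n = Injection.injective (↔⇒↣ (↔-sym (+↔⊎ {m} {n})))

nonconstant⇒avoids : {f : A → Fin n} → (∃ λ x → ∃ λ y → f x ≢ f y) → ∀ v → ∃ λ z → f z ≢ v
nonconstant⇒avoids {f = f} (x , y , fx≢fy) v with f x ≟ v
... | yes fx≡v = y , λ fy≡v → fx≢fy (trans fx≡v (sym fy≡v))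
... | no  fx≢v = x , fx≢v

module Count {P : Pred (Fin n) ℓ} (P? : Decidable P) where

  members : List (Fin n)
  members = filter P? (allFin n)

  count : ℕ
  count = length members

  position : ∀ {c} → P c → Fin count
  position {c} p = index (∈-filter⁺ P? (∈-allFin c) p)

  position-injective : ∀ {c c′} (p : P c) (p′ : P c′) → position p ≡ position p′ → c ≡ c′
  position-injective {c} {c′} p p′ eq = begin
    c                            ≡⟨ lookup-index (∈-filter⁺ P? (∈-allFin c) p) ⟩
    lookup members (position p)  ≡⟨ cong (lookup members) eq ⟩
    lookup members (position p′) ≡⟨ lookup-index (∈-filter⁺ P? (∈-allFin c′) p′) ⟨
    c′                           ∎
    where open ≡-Reasoning

  module _ {c} (c∈P : P c) where

    Punctured : Pred (Fin n) ℓ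
    Punctured x = P x × x ≢ c

    private
      positions : ∀ {s} → All Punctured Punctured s → Fin count ⊎ Fin count
      positions (inj₁ (p , _)) = inj₁ (position p)
      positions (inj₂ (p , _)) = inj₂ (position p)

      positions-injective : ∀ {s s′} (u : All Punctured Punctured s) (u′ : All Punctured Punctured s′) →
                            positions u ≡ positions u′ → s ≡ s′
      positions-injective (inj₁ (p , _)) (inj₁ (p′ , _)) eq =
        cong inj₁ (position-injective p p′ (inj₁-injective eq))
      positions-injective (inj₂ (p , _)) (inj₂ (p′ , _)) eq =
        cong inj₂ (position-injective p p′ (inj₂-injective eq))

      positions≢inj₁c : ∀ {s} (u : All Punctured Punctured s) → positions u ≢ inj₁ (position c∈P)
      positions≢inj₁c (inj₁ (p , x≢c)) eq = x≢c (position-injective p c∈P (inj₁-injective eq))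

      positions≢inj₂c : ∀ {s} (u : All Punctured Punctured s) → positions u ≢ inj₂ (position c∈P)
      positions≢inj₂c (inj₂ (p , x≢c)) eq = x≢c (position-injective p c∈P (inj₂-injective eq))

    punctured-⊎-injection⇒< : (ρ : Fin m → Fin n ⊎ Fin n) → Injective _≡_ _≡_ ρ →
                              (∀ i → All Punctured Punctured (ρ i)) → m + 1 < 2 * count
    punctured-⊎-injection⇒< {m} ρ ρ-injective ρ-punctured = begin-strict
      m + 1         ≡⟨ ℕ.+-comm m 1 ⟩
      suc m         <⟨ injective⇒≤ (λ eq → κ-injective (join-injective count count eq)) ⟩
      count + count ≡⟨ cong (count +_) (ℕ.+-identityʳ count) ⟨
      2 * count     ∎
      where
      open ℕ.≤-Reasoning
      ι : Fin m → Fin count ⊎ Fin count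
      ι i = positions (ρ-punctured i)
      ι-injective : Injective _≡_ _≡_ ι
      ι-injective {i} {j} eq = ρ-injective (positions-injective (ρ-punctured i) (ρ-punctured j) eq)
      κ : Fin (suc (suc m)) → Fin count ⊎ Fin count
      κ = inj₁ (position c∈P) ∷ inj₂ (position c∈P) ∷ ι
      κ-injective : Injective _≡_ _≡_ κ
      κ-injective = fresh∷-injective κ≢inj₁c
        (fresh∷-injective (λ i → positions≢inj₂c (ρ-punctured i)) ι-injective)
        where
        κ≢inj₁c : ∀ i → (inj₂ (position c∈P) ∷ ι) i ≢ inj₁ (position c∈P)
        κ≢inj₁c zero    ()
        κ≢inj₁c (suc i) = positions≢inj₁c (ρ-punctured i)

module Collision {q} (𝔽 : FiniteField q) (f : Fin q → Fin q) {a b z₀ : Fin q}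
                 (a≢b : a ≢ b) (fa≡fb : f a ≡ f b) (fz₀≢fa : f z₀ ≢ f a) where
  open FiniteField 𝔽 using (0#)
  open Directions 𝔽 f
  open Count (inQuotientSet? 𝔽 f)

  private
    0∈Q : InQuotientSet 𝔽 f 0#
    0∈Q = collision⇒0∈Q fz₀≢fa a≢b fa≡fb

  ratios : Fin q → Fin q ⊎ Fin q
  ratios z with f z ≟ f a
  ... | no  _ = inj₁ (ratio z a b)
  ... | yes _ = inj₂ (ratio z₀ a z)

  ratios-injective : Injective _≡_ _≡_ ratios
  ratios-injective {z} {z′} eq with f z ≟ f a | f z′ ≟ f a
  ... | no  fz≢fa | no  fz′≢fa = ratio-injective₁ a≢b fa≡fb fz≢fa fz′≢fa (inj₁-injective eq)
  ... | yes fz≡fa | yes fz′≡fa = ratio-injective₃ fz₀≢fa fz≡fa fz′≡fa (inj₂-injective eq)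

  ratios-punctured : ∀ z → All (Punctured 0∈Q) (Punctured 0∈Q) (ratios z)
  ratios-punctured z with f z ≟ f a
  ... | no  fz≢fa = inj₁ (ratio∈Q fz≢fa fa≡fb , ratio≢0 fz≢fa fa≡fb)
  ... | yes fz≡fa = inj₂ (ratio∈Q fz₀≢fa (sym fz≡fa) , ratio≢0 fz₀≢fa (sym fz≡fa))

  collision⇒< : q + 1 < 2 * quotientSetSize 𝔽 f
  collision⇒< = punctured-⊎-injection⇒< 0∈Q ratios ratios-injective ratios-punctured

corollary3 : (p n q : ℕ) → Prime p → q ≡ p ^ n →
    (𝔽 : FiniteField q) → (f : Fin q → Fin q) →
    (∃ λ x → ∃ λ y → f x ≢ f y) →
    2 * quotientSetSize 𝔽 f ≤ q + 1 →
    Bijective _≡_ _≡_ f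
corollary3 _ _ q _ _ 𝔽 f nonconstant 2|Q|≤q+1 = f-injective , injective⇒surjective f-injective
  where
  f-injective : Injective _≡_ _≡_ f
  f-injective {a} {b} fa≡fb with a ≟ b
  ... | yes a≡b = a≡b
  ... | no  a≢b with nonconstant⇒avoids nonconstant (f a)
  ...   | z₀ , fz₀≢fa = contradiction 2|Q|≤q+1 (ℕ.<⇒≱ (Collision.collision⇒< 𝔽 f a≢b fa≡fb fz₀≢fa))
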